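{- For integers $k\geq 2$ and $n\geq 4$: if $n$ is even then $\mathrm{R}_k(W_n)\geq 3^{k-1}(n-1)+1$, and if $n$ is odd then $\mathrm{R}_k(W_n)\geq 2^{k-2}(2n-1)+1$.
   Context: For an integer $n\geq 4$, the wheel $W_n$ is the graph on $n$ vertices obtained from the cycle $C_{n-1}$ by adding one new vertex adjacent to every vertex of the cycle. For a graph $G$ and a positive integer $k$, $\mathrm{R}_k(G)$ is the smallest integer $N$ such that every coloring of the edges of $K_N$ with $k$ colors contains a monochromatic copy of $G$. -}

module Defs where

open import Data.Nat using (ℕ; zero; suc; _∸_; _≤_)
open import Data.Fin using (Fin; zero; suc; toℕ)
open import Data.Product using (Σ; ∃; _×_)
open import Function.Definitions using (Injective)
open import Relation.Binary.PropositionalEquality using (_≡_)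

-- Edge relation of the wheel W_n on vertex set Fin n (n = suc m):
-- vertex zero is the hub; vertices suc i (i : Fin m) form the cycle C_m
-- in the cyclic order 0,1,...,m-1,0.
data WheelEdge : (n : ℕ) → Fin n → Fin n → Set where
  spoke : ∀ {m} (i : Fin m) → WheelEdge (suc m) zero (suc i)
  rim   : ∀ {m} (i j : Fin m) → suc (toℕ i) ≡ toℕ j → WheelEdge (suc m) (suc i) (suc j)
  wrap  : ∀ {m} (i j : Fin m) → suc (toℕ i) ≡ m → toℕ j ≡ 0 →
          WheelEdge (suc m) (suc i) (suc j)

-- A k-edge-colouring of the complete graph K_N: a symmetric colour
-- function on pairs of vertices (values on the diagonal are irrelevant).
SymColouring : (N k : ℕ) → Set
SymColouring N k = Σ (Fin N → Fin N → Fin k) λ c → ∀ i j → c i j ≡ c j i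

HasMonoWheel : ∀ {N k} → SymColouring N k → ℕ → Set
HasMonoWheel {N} {k} (c Data.Product., _) n =
  Σ (Fin n → Fin N) λ f → Injective _≡_ _≡_ f ×
    Σ (Fin k) λ col → ∀ u v → WheelEdge n u v → c (f u) (f v) ≡ col

RamseyArrow : ℕ → ℕ → ℕ → Set
RamseyArrow N k n = (c : SymColouring N k) → HasMonoWheel c n

-- R_k(W_n) ≥ M  ⇔  every N with the Ramsey property satisfies M ≤ N
-- (R_k(W_n) is the least such N).
RamseyWheelAtLeast : ℕ → ℕ → ℕ → Set
RamseyWheelAtLeast k n M = ∀ N → RamseyArrow N k n → M ≤ N

-- A k-colouring of K_X without monochromatic W_n can be blown up: take P copies of it and give
-- every edge between distinct copies a new colour. If W_n has no proper vertex colouring with P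
-- colours, this is a (k+1)-colouring of K_{PX} still without monochromatic W_n. For even n the rim
-- of W_n is an odd cycle, so P = 3 works, starting from K_{n-1} in a single colour. For odd n,
-- P = 2 works, starting from a 2-colouring of K_{2n-1} without monochromatic W_n: for n ≥ 7 a red
-- K_{n-1} joined in blue to n vertices split into blue clusters of sizes 2 and 3 with red edges
-- between clusters, and for n = 5 a circulant colouring of K_9.
module Submission where

open import Data.Bool using (if_then_else_)
open import Data.Empty using (⊥)
open import Data.Fin using (Fin; zero; suc; toℕ; inject₁; fromℕ; punchOut)
open import Data.Fin.Patterns using (0F; 1F; 2F; 3F; 4F; 5F)
open import Data.Fin.Properties
  using ( _≟_; all?; injective⇒≤; <⇒notInjective; suc-injective; toℕ-injective; inject₁-injective
        ; inject≤-injective; punchOut-injective; toℕ-inject₁; toℕ-fromℕ; +↔⊎; *↔×)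
open import Data.List using ([]; _∷_)
open import Data.List.Relation.Unary.Unique.Propositional.Properties using (map⁺; allFin⁺)
open import Data.Nat
  using (ℕ; zero; suc; _≤_; _<_; _+_; _*_; _∸_; _^_; _⊓_; _≤ᵇ_; _%_; _/_; ⌈_/2⌉; ∣_-_∣; z≤n; s≤s)
open import Data.Nat.DivMod using (m≡m%n+[m/n]*n)
open import Data.Nat.Properties
  using (≤-reflexive; ≮⇒≥; m<1+n⇒m≤n; n<1+n; +-identityʳ; +-comm; *-assoc; ∣-∣-comm)
open import Data.Product using (Σ; ∃; _×_; _,_; proj₁; proj₂)
open import Data.Product.Function.NonDependent.Propositional using (_×-↣_)
open import Data.Product.Properties using (×-≡,≡→≡)
open import Data.Sum using (_⊎_; inj₁; inj₂)
open import Data.Sum.Function.Propositional using (_⊎-↔_)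
open import Function using (_∘_)
open import Function.Bundles using (_↣_; _↔_; Injection; mk↣)
open import Function.Construct.Composition using (_↣-∘_; _↔-∘_)
open import Function.Construct.Identity using (↣-id; ↔-id)
open import Function.Construct.Symmetry using (↔-sym)
open import Function.Definitions using (Injective)
open import Function.Properties.Inverse using (↔⇒↣)
open import Relation.Nullary using (¬_; ¬?; yes; no; contradiction; _→-dec_)
open import Relation.Nullary.Decidable using (from-yes)
open import Relation.Binary.PropositionalEquality

open import Defs

open Injection using (to; injective)

MonoWheel : {V : Set} {k : ℕ} → (V → V → Fin k) → ℕ → Set
MonoWheel {V} {k} c n =
  Σ (Fin n → V) λ f → Injective _≡_ _≡_ f ×
    Σ (Fin k) λ col → ∀ u v → WheelEdge n u v → c (f u) (f v) ≡ col

record WheelFreeColouring (k n X : ℕ) : Set₁ where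
  field
    Vertex     : Set
    colour     : Vertex → Vertex → Fin k
    colour-sym : ∀ x y → colour x y ≡ colour y x
    wheelFree  : ¬ MonoWheel colour n
    embedding  : Fin X ↣ Vertex

restrict : ∀ {k n X Y} → Y ≤ X → WheelFreeColouring k n X → WheelFreeColouring k n Y
restrict Y≤X χ = record
  { Vertex     = Vertex
  ; colour     = colour
  ; colour-sym = colour-sym
  ; wheelFree  = wheelFree
  ; embedding  = embedding ↣-∘ mk↣ (inject≤-injective Y≤X Y≤X _ _)
  }
  where open WheelFreeColouring χ

¬RamseyArrow : ∀ {k n N} → WheelFreeColouring k n N → ¬ RamseyArrow N k n
¬RamseyArrow {k} {n} {N} χ arrow = wheelFree (pushForward (arrow pullBack))
  where
  open WheelFreeColouring χ

  e : Fin N → Vertex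
  e = to embedding

  pullBack : SymColouring N k
  pullBack = (λ i j → colour (e i) (e j)) , λ i j → colour-sym (e i) (e j)

  pushForward : HasMonoWheel pullBack n → MonoWheel colour n
  pushForward (f , f-inj , col , mono) = e ∘ f , f-inj ∘ injective embedding , col , mono

ramseyWheelAtLeast : ∀ {k n X} → WheelFreeColouring k n X → RamseyWheelAtLeast k n (X + 1)
ramseyWheelAtLeast {X = X} χ N arrow = ≮⇒≥ λ N<X+1 →
  ¬RamseyArrow (restrict (m<1+n⇒m≤n (subst (N <_) (+-comm X 1) N<X+1)) χ) arrow

IsProperColouring : ∀ {P n} → (Fin n → Fin P) → Set
IsProperColouring {n = n} p = ∀ {u v} → WheelEdge n u v → p u ≢ p v

Colourable : ℕ → ℕ → Set
Colourable P n = Σ (Fin n → Fin P) IsProperColouring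

IsProperRimColouring : ∀ {P m} → (Fin m → Fin P) → Set
IsProperRimColouring {m = m} q = ∀ {i j} → WheelEdge (suc m) (suc i) (suc j) → q i ≢ q j

-- The rim avoids the hub's colour, so punching it out leaves one colour fewer.
rimColouring : ∀ {P m} {p : Fin (suc m) → Fin (suc P)} → IsProperColouring p →
               Σ (Fin m → Fin P) IsProperRimColouring
rimColouring proper =
  (λ i → punchOut (proper (spoke i))) ,
  λ e eq → proper e (punchOut-injective (proper (spoke _)) (proper (spoke _)) eq)

≢-≢⇒≡ : {x y z : Fin 2} → x ≢ y → y ≢ z → x ≡ z
≢-≢⇒≡ {zero}     {zero}     x≢y _   = contradiction refl x≢y
≢-≢⇒≡ {suc zero} {suc zero} x≢y _   = contradiction refl x≢y
≢-≢⇒≡ {zero}     {suc zero} {zero}     _ _   = refl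
≢-≢⇒≡ {zero}     {suc zero} {suc zero} _ y≢z = contradiction refl y≢z
≢-≢⇒≡ {suc zero} {zero}     {zero}     _ y≢z = contradiction refl y≢z
≢-≢⇒≡ {suc zero} {zero}     {suc zero} _ _   = refl

evenPath-ends-sameColour : ∀ s (q : Fin (suc (s * 2)) → Fin 2) →
  (∀ i → q (inject₁ i) ≢ q (suc i)) → q (fromℕ (s * 2)) ≡ q zero
evenPath-ends-sameColour zero    _ _      = refl
evenPath-ends-sameColour (suc s) q proper = begin
  q (suc (suc end))               ≡⟨ sym (≢-≢⇒≡ (proper (inject₁ end)) (proper (suc end))) ⟩
  q (inject₁ (inject₁ end))       ≡⟨ evenPath-ends-sameColour s (q ∘ inject₁ ∘ inject₁)
                                       (proper ∘ inject₁ ∘ inject₁) ⟩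
  q zero                          ∎
  where
  open ≡-Reasoning
  end = fromℕ (s * 2)

oddRim-¬2-colourable : ∀ s (q : Fin (suc (s * 2)) → Fin 2) → ¬ IsProperRimColouring q
oddRim-¬2-colourable s q proper =
  proper (wrap (fromℕ (s * 2)) zero (cong suc (toℕ-fromℕ (s * 2))) refl)
         (evenPath-ends-sameColour s q λ i →
            proper (rim (inject₁ i) (suc i) (cong suc (toℕ-inject₁ i))))

rim-¬1-colourable : ∀ {t} (q : Fin (2 + t) → Fin 1) → ¬ IsProperRimColouring q
rim-¬1-colourable q proper with q zero | q (suc zero) | proper (rim zero (suc zero) refl)
... | zero | zero | q₀≢q₁ = q₀≢q₁ refl

evenWheel-¬3-colourable : ∀ s → ¬ Colourable 3 (2 + s * 2)
evenWheel-¬3-colourable s (_ , proper) = oddRim-¬2-colourable s _ (proj₂ (rimColouring proper))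

wheel-¬2-colourable : ∀ t → ¬ Colourable 2 (3 + t)
wheel-¬2-colourable _ (_ , proper) = rim-¬1-colourable _ (proj₂ (rimColouring proper))

module BlowUp {V : Set} {K : ℕ} (P : ℕ) (c : V → V → Fin K) where

  colour : Fin P × V → Fin P × V → Fin (suc K)
  colour (a , x) (b , y) with a ≟ b
  ... | yes _ = suc (c x y)
  ... | no _  = zero

  colour-sym : (∀ x y → c x y ≡ c y x) → ∀ p q → colour p q ≡ colour q p
  colour-sym c-sym (a , x) (b , y) with a ≟ b | b ≟ a
  ... | yes _   | yes _   = cong suc (c-sym x y)
  ... | yes a≡b | no  b≢a = contradiction (sym a≡b) b≢a
  ... | no  a≢b | yes b≡a = contradiction (sym b≡a) a≢b
  ... | no  _   | no  _   = refl

  colour≡zero⇒≢ : ∀ {a b x y} → colour (a , x) (b , y) ≡ zero → a ≢ b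
  colour≡zero⇒≢ {a} {b} eq with a ≟ b
  colour≡zero⇒≢ () | yes _
  ... | no a≢b = a≢b

  colour≡suc⇒≡ : ∀ {a b x y col} → colour (a , x) (b , y) ≡ suc col → a ≡ b × c x y ≡ col
  colour≡suc⇒≡ {a} {b} eq with a ≟ b
  colour≡suc⇒≡ refl | yes a≡b = a≡b , refl
  colour≡suc⇒≡ ()   | no _

  -- A wheel in the new colour is properly coloured by the copy index; a wheel in an old
  -- colour stays in the copy of its hub, since every vertex is joined to the hub.
  wheelFree : ∀ {m} → ¬ Colourable P (suc m) → ¬ MonoWheel c (suc m) → ¬ MonoWheel colour (suc m)
  wheelFree ¬colourable _ (f , _ , zero , mono) =
    ¬colourable (proj₁ ∘ f , λ {u} {v} e → colour≡zero⇒≢ (mono u v e))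
  wheelFree _ c-wheelFree (f , f-inj , suc col , mono) =
    c-wheelFree (proj₂ ∘ f , proj₂∘f-inj , col , λ u v e → proj₂ (colour≡suc⇒≡ (mono u v e)))
    where
    copyOfHub : ∀ u → proj₁ (f u) ≡ proj₁ (f zero)
    copyOfHub zero    = refl
    copyOfHub (suc i) = sym (proj₁ (colour≡suc⇒≡ (mono zero (suc i) (spoke i))))

    proj₂∘f-inj : Injective _≡_ _≡_ (proj₂ ∘ f)
    proj₂∘f-inj {u} {v} eq = f-inj (×-≡,≡→≡ (trans (copyOfHub u) (sym (copyOfHub v)) , eq))

blowUp : ∀ {k m X} P → ¬ Colourable P (suc m) →
         WheelFreeColouring k (suc m) X → WheelFreeColouring (suc k) (suc m) (P * X)
blowUp P ¬colourable χ = record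
  { Vertex     = Fin P × Vertex
  ; colour     = BlowUp.colour P colour
  ; colour-sym = BlowUp.colour-sym P colour colour-sym
  ; wheelFree  = BlowUp.wheelFree P colour ¬colourable wheelFree
  ; embedding  = (↣-id _ ×-↣ embedding) ↣-∘ ↔⇒↣ *↔×
  }
  where open WheelFreeColouring χ

iterateBlowUp : ∀ {k m X} P → ¬ Colourable P (suc m) → ∀ j →
                WheelFreeColouring k (suc m) X → WheelFreeColouring (j + k) (suc m) (P ^ j * X)
iterateBlowUp {X = X} P ¬colourable zero χ = restrict (≤-reflexive (+-identityʳ X)) χ
iterateBlowUp {X = X} P ¬colourable (suc j) χ =
  restrict (≤-reflexive (*-assoc P (P ^ j) X))
           (blowUp P ¬colourable (iterateBlowUp P ¬colourable j χ))

factorThrough : {A B C : Set} (e : B → C) {f : A → C} → Injective _≡_ _≡_ f →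
                (∀ a → ∃ λ b → f a ≡ e b) → A ↣ B
factorThrough e {f} f-inj preimage = mk↣ {to = proj₁ ∘ preimage} λ {a} {a'} eq → f-inj (begin
  f a                      ≡⟨ proj₂ (preimage a) ⟩
  e (proj₁ (preimage a))   ≡⟨ cong e eq ⟩
  e (proj₁ (preimage a'))  ≡⟨ proj₂ (preimage a') ⟨
  f a'                     ∎)
  where open ≡-Reasoning

avoiding↣ : {A : Set} {t : ℕ} (g : A ↣ Fin (suc t)) {x : Fin (suc t)} →
            (∀ a → x ≢ to g a) → A ↣ Fin t
avoiding↣ g avoids = mk↣ {to = λ a → punchOut (avoids a)} λ eq →
  injective g (punchOut-injective (avoids _) (avoids _) eq)

constantAlongPath : {A : Set} {m : ℕ} (κ : Fin (suc m) → A) →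
                    (∀ i → κ (inject₁ i) ≡ κ (suc i)) → ∀ i → κ i ≡ κ zero
constantAlongPath _ _ zero = refl
constantAlongPath {m = suc _} κ step (suc i) =
  trans (sym (step i)) (constantAlongPath (κ ∘ inject₁) (step ∘ inject₁) i)

monochromaticColouring : ∀ m → WheelFreeColouring 1 (suc m) m
monochromaticColouring m = record
  { Vertex     = Fin m
  ; colour     = λ _ _ → zero
  ; colour-sym = λ _ _ → refl
  ; wheelFree  = λ (_ , f-inj , _) → <⇒notInjective (n<1+n m) f-inj
  ; embedding  = ↣-id _
  }

pattern red  = zero
pattern blue = suc zero

module LargeOddWheel (s : ℕ) where

  m : ℕ
  m = 6 + s * 2

  Clustered : Set
  Clustered = Fin 3 ⊎ (Fin (2 + s) × Fin 2)

  clustered↔ : Fin (suc m) ↔ Clustered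
  clustered↔ = (↔-id _ ⊎-↔ *↔× {2 + s} {2}) ↔-∘ +↔⊎ {3} {(2 + s) * 2}

  cluster : Clustered → Fin (3 + s)
  cluster (inj₁ _)       = zero
  cluster (inj₂ (a , _)) = suc a

  position : Clustered → Fin 3
  position (inj₁ i)       = i
  position (inj₂ (_ , i)) = inject₁ i

  cluster-position-injective : ∀ {x y} → cluster x ≡ cluster y → position x ≡ position y → x ≡ y
  cluster-position-injective {inj₁ _}       {inj₁ _} _    refl = refl
  cluster-position-injective {inj₂ (a , _)} {inj₂ _} refl eq   =
    cong (inj₂ ∘ (a ,_)) (inject₁-injective eq)
  cluster-position-injective {inj₁ _}       {inj₂ _} ()
  cluster-position-injective {inj₂ _}       {inj₁ _} ()

  sameCluster⇒≤3 : ∀ {t c} (g : Fin t ↣ Clustered) → (∀ i → cluster (to g i) ≡ c) → t ≤ 3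
  sameCluster⇒≤3 g inCluster = injective⇒≤ {f = position ∘ to g} λ eq →
    injective g (cluster-position-injective (trans (inCluster _) (sym (inCluster _))) eq)

  clustermate : ∀ x → ∃ λ y → y ≢ x × cluster y ≡ cluster x
  clustermate (inj₁ zero)        = inj₁ (suc zero) , (λ ()) , refl
  clustermate (inj₁ (suc _))     = inj₁ zero , (λ ()) , refl
  clustermate (inj₂ (a , zero))  = inj₂ (a , suc zero) , (λ ()) , refl
  clustermate (inj₂ (a , suc _)) = inj₂ (a , zero) , (λ ()) , refl

  clusterColour : Clustered → Clustered → Fin 2
  clusterColour x y with cluster x ≟ cluster y
  ... | yes _ = blue
  ... | no  _ = red

  Vertex : Set
  Vertex = Fin m ⊎ Clustered

  colour : Vertex → Vertex → Fin 2
  colour (inj₁ _) (inj₁ _) = red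
  colour (inj₁ _) (inj₂ _) = blue
  colour (inj₂ _) (inj₁ _) = blue
  colour (inj₂ x) (inj₂ y) = clusterColour x y

  colour-sym : ∀ v w → colour v w ≡ colour w v
  colour-sym (inj₁ _) (inj₁ _) = refl
  colour-sym (inj₁ _) (inj₂ _) = refl
  colour-sym (inj₂ _) (inj₁ _) = refl
  colour-sym (inj₂ x) (inj₂ y) with cluster x ≟ cluster y | cluster y ≟ cluster x
  ... | yes _   | yes _   = refl
  ... | yes x~y | no  y≁x = contradiction (sym x~y) y≁x
  ... | no  x≁y | yes y~x = contradiction (sym y~x) x≁y
  ... | no  _   | no  _   = refl

  blue⇒sameCluster : ∀ {x y} → colour (inj₂ x) (inj₂ y) ≡ blue → cluster x ≡ cluster y
  blue⇒sameCluster {x} {y} eq with cluster x ≟ cluster y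
  ... | yes x~y = x~y
  blue⇒sameCluster () | no _

  red⇒otherCluster : ∀ {x v} → colour (inj₂ x) v ≡ red → ∃ λ y → v ≡ inj₂ y × cluster x ≢ cluster y
  red⇒otherCluster {x} {inj₂ y} eq with cluster x ≟ cluster y
  red⇒otherCluster () | yes _
  ... | no x≁y = y , refl , x≁y

  red⇒inClique : ∀ {a v} → colour (inj₁ a) v ≡ red → ∃ λ a' → v ≡ inj₁ a'
  red⇒inClique {v = inj₁ a'} _ = a' , refl

  blue⇒inClustered : ∀ {a v} → colour (inj₁ a) v ≡ blue → ∃ λ y → v ≡ inj₂ y
  blue⇒inClustered {v = inj₂ y} _ = y , refl

  -- The clique is red, so a blue edge seen in blue from x has an end in the cluster of x.
  blueTriangle : ∀ {x v w} → colour v w ≡ blue →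
                 colour (inj₂ x) v ≡ blue → colour (inj₂ x) w ≡ blue →
                 ∃ λ y → (v ≡ inj₂ y ⊎ w ≡ inj₂ y) × cluster x ≡ cluster y
  blueTriangle {v = inj₂ y} _ xv _  = y , inj₁ refl , blue⇒sameCluster xv
  blueTriangle {v = inj₁ _} {inj₂ y} _ _ xw = y , inj₂ refl , blue⇒sameCluster xw

  module _ (f : Fin (suc m) → Vertex) (f-inj : Injective _≡_ _≡_ f) where

    Monochromatic : Fin 2 → Set
    Monochromatic col = ∀ u v → WheelEdge (suc m) u v → colour (f u) (f v) ≡ col

    edgeColour : ∀ {col u v p q} → Monochromatic col → WheelEdge (suc m) u v →
                 f u ≡ p → f v ≡ q → colour p q ≡ col
    edgeColour {u = u} {v} mono e refl refl = mono u v e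

    redHub-inClique : ∀ {a} → Monochromatic red → f zero ≡ inj₁ a → ⊥
    redHub-inClique {a} mono hub =
      <⇒notInjective (n<1+n m) (injective (factorThrough inj₁ f-inj inClique))
      where
      inClique : ∀ u → ∃ λ a' → f u ≡ inj₁ a'
      inClique zero    = a , hub
      inClique (suc i) = red⇒inClique (edgeColour mono (spoke i) hub refl)

    redHub-inClustered : ∀ {x} → Monochromatic red → f zero ≡ inj₂ x → ⊥
    redHub-inClustered {x} mono hub =
      <⇒notInjective (n<1+n m) (injective (avoiding↣ (code ↣-∘ g) avoidsMate))
      where
      mate : Clustered
      mate = proj₁ (clustermate x)

      mate≢x : mate ≢ x
      mate≢x = proj₁ (proj₂ (clustermate x))

      mate~x : cluster mate ≡ cluster x
      mate~x = proj₂ (proj₂ (clustermate x))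

      inClustered : ∀ u → Σ Clustered λ y → f u ≡ inj₂ y × y ≢ mate
      inClustered zero = x , hub , mate≢x ∘ sym
      inClustered (suc i)
        with y , fy , x≁y ← red⇒otherCluster (edgeColour mono (spoke i) hub refl) =
        y , fy , λ y≡mate → x≁y (trans (sym mate~x) (cong cluster (sym y≡mate)))

      g : Fin (suc m) ↣ Clustered
      g = factorThrough inj₂ f-inj λ u → proj₁ (inClustered u) , proj₁ (proj₂ (inClustered u))

      code : Clustered ↣ Fin (suc m)
      code = ↔⇒↣ (↔-sym clustered↔)

      avoidsMate : ∀ u → to code mate ≢ to code (to g u)
      avoidsMate u eq = proj₂ (proj₂ (inClustered u)) (sym (injective code eq))

    blueHub-inClique : ∀ {a} → Monochromatic blue → f zero ≡ inj₁ a → ⊥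
    blueHub-inClique mono hub =
      contradiction (sameCluster⇒≤3 rim↣ sameCluster) λ { (s≤s (s≤s (s≤s ()))) }
      where
      inClustered : ∀ i → ∃ λ y → f (suc i) ≡ inj₂ y
      inClustered i = blue⇒inClustered (edgeColour mono (spoke i) hub refl)

      rim↣ : Fin m ↣ Clustered
      rim↣ = factorThrough inj₂ (suc-injective ∘ f-inj) inClustered

      sameCluster : ∀ i → cluster (to rim↣ i) ≡ cluster (to rim↣ zero)
      sameCluster = constantAlongPath (cluster ∘ to rim↣) λ i → blue⇒sameCluster
        (edgeColour mono (rim (inject₁ i) (suc i) (cong suc (toℕ-inject₁ i)))
                    (proj₂ (inClustered _)) (proj₂ (inClustered _)))

    blueHub-inClustered : ∀ {x} → Monochromatic blue → f zero ≡ inj₂ x → ⊥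
    blueHub-inClustered {x} mono hub =
      contradiction (sameCluster⇒≤3 g inCluster) λ { (s≤s (s≤s (s≤s ()))) }
      where
      Classmate : ℕ → Set
      Classmate r = Σ (Fin (suc m)) λ u → ⌈ toℕ u /2⌉ ≡ r ×
                      Σ Clustered λ y → f u ≡ inj₂ y × cluster y ≡ cluster x

      classmateOnEdge : ∀ {i j} → WheelEdge (suc m) (suc i) (suc j) →
                        ⌈ toℕ (suc i) /2⌉ ≡ ⌈ toℕ (suc j) /2⌉ → Classmate ⌈ toℕ (suc j) /2⌉
      classmateOnEdge {i} {j} e sameHalf
        with blueTriangle (edgeColour mono e refl refl) (edgeColour mono (spoke i) hub refl)
                          (edgeColour mono (spoke j) hub refl)
      ... | y , inj₁ fi≡y , x~y = suc i , sameHalf , y , fi≡y , sym x~y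
      ... | y , inj₂ fj≡y , x~y = suc j , refl , y , fj≡y , sym x~y

      -- The hub and one end of each of the disjoint rim edges {1,2}, {3,4}, {5,6};
      -- ⌈u/2⌉ tells them apart.
      classmate : (r : Fin 4) → Classmate (toℕ r)
      classmate 0F = zero , refl , x , hub , refl
      classmate 1F = classmateOnEdge (rim 0F 1F refl) refl
      classmate 2F = classmateOnEdge (rim 2F 3F refl) refl
      classmate 3F = classmateOnEdge (rim 4F 5F refl) refl

      classmate-injective : Injective _≡_ _≡_ (proj₁ ∘ classmate)
      classmate-injective {r} {r'} eq = toℕ-injective (begin
        toℕ r                             ≡⟨ proj₁ (proj₂ (classmate r)) ⟨
        ⌈ toℕ (proj₁ (classmate r)) /2⌉   ≡⟨ cong (⌈_/2⌉ ∘ toℕ) eq ⟩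
        ⌈ toℕ (proj₁ (classmate r')) /2⌉  ≡⟨ proj₁ (proj₂ (classmate r')) ⟩
        toℕ r'                            ∎)
        where open ≡-Reasoning

      g : Fin 4 ↣ Clustered
      g = factorThrough inj₂ (classmate-injective ∘ f-inj) λ r →
            let (_ , _ , y , fy , _) = classmate r in y , fy

      inCluster : ∀ r → cluster (to g r) ≡ cluster x
      inCluster r = let (_ , _ , _ , _ , y~x) = classmate r in y~x

  wheelFree : ¬ MonoWheel colour (suc m)
  wheelFree (f , f-inj , red , mono) with f zero in hub
  ... | inj₁ _ = redHub-inClique f f-inj mono hub
  ... | inj₂ _ = redHub-inClustered f f-inj mono hub
  wheelFree (f , f-inj , blue , mono) with f zero in hub
  ... | inj₁ _ = blueHub-inClique f f-inj mono hub
  ... | inj₂ _ = blueHub-inClustered f f-inj mono hub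

  colouring : WheelFreeColouring 2 (suc m) (2 * suc m ∸ 1)
  colouring = restrict (≤-reflexive (cong (λ k → m + suc k) (+-identityʳ m))) (record
    { Vertex     = Vertex
    ; colour     = colour
    ; colour-sym = colour-sym
    ; wheelFree  = wheelFree
    ; embedding  = ↔⇒↣ ((↔-id _ ⊎-↔ clustered↔) ↔-∘ +↔⊎ {m} {suc m})
    })

module FiveWheel where

  open import Data.List.Relation.Unary.Unique.DecPropositional (_≟_ {9}) using (Unique; unique?)

  colour : Fin 9 → Fin 9 → Fin 2
  colour x y = if d ⊓ (9 ∸ d) ≤ᵇ 2 then red else blue
    where d = ∣ toℕ x - toℕ y ∣

  colour-sym : ∀ x y → colour x y ≡ colour y x
  colour-sym x y rewrite ∣-∣-comm (toℕ x) (toℕ y) = refl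

  -- Exhaustive search; rim vertices are added one at a time so that a wrongly coloured edge
  -- prunes the remaining choices.
  noMonoWheel : ∀ h a b → colour h b ≡ colour h a → colour a b ≡ colour h a →
                ∀ c → colour h c ≡ colour h a → colour b c ≡ colour h a →
                ∀ d → colour h d ≡ colour h a → colour c d ≡ colour h a → colour d a ≡ colour h a →
                ¬ Unique (h ∷ a ∷ b ∷ c ∷ d ∷ [])
  noMonoWheel = from-yes (all? λ h → all? λ a → all? λ b →
    (colour h b ≟ colour h a) →-dec (colour a b ≟ colour h a) →-dec all? λ c →
    (colour h c ≟ colour h a) →-dec (colour b c ≟ colour h a) →-dec all? λ d →
    (colour h d ≟ colour h a) →-dec (colour c d ≟ colour h a) →-dec (colour d a ≟ colour h a) →-dec
    ¬? (unique? (h ∷ a ∷ b ∷ c ∷ d ∷ [])))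

  wheelFree : ¬ MonoWheel colour 5
  wheelFree (f , f-inj , _ , mono) =
    noMonoWheel (f 0F) (f 1F) (f 2F) (asSpoke₀ (spoke 1F)) (asSpoke₀ (rim 0F 1F refl))
                (f 3F) (asSpoke₀ (spoke 2F)) (asSpoke₀ (rim 1F 2F refl))
                (f 4F) (asSpoke₀ (spoke 3F)) (asSpoke₀ (rim 2F 3F refl))
                       (asSpoke₀ (wrap 3F 0F refl refl))
                (map⁺ f-inj (allFin⁺ 5))
    where
    asSpoke₀ : ∀ {u v} → WheelEdge 5 u v → colour (f u) (f v) ≡ colour (f 0F) (f 1F)
    asSpoke₀ {u} {v} e = trans (mono u v e) (sym (mono 0F 1F (spoke 0F)))

  colouring : WheelFreeColouring 2 5 9
  colouring = record
    { Vertex     = Fin 9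
    ; colour     = colour
    ; colour-sym = colour-sym
    ; wheelFree  = wheelFree
    ; embedding  = ↣-id _
    }

ramseyBound : ∀ {K k m X} P j → ¬ Colourable P (suc m) → WheelFreeColouring K (suc m) X →
              j + K ≡ k → RamseyWheelAtLeast k (suc m) (P ^ j * X + 1)
ramseyBound P j ¬colourable χ refl = ramseyWheelAtLeast (iterateBlowUp P ¬colourable j χ)

evenView : ∀ n → 4 ≤ n → n % 2 ≡ 0 → ∃ λ q → n ≡ 2 + q * 2
evenView n 4≤n n%2≡0 = view (n / 2) (trans (m≡m%n+[m/n]*n n 2) (cong (_+ n / 2 * 2) n%2≡0)) 4≤n
  where
  view : ∀ {n} h → n ≡ h * 2 → 4 ≤ n → ∃ λ q → n ≡ 2 + q * 2
  view zero    refl ()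
  view (suc q) n≡  _ = q , n≡

oddView : ∀ n → 4 ≤ n → n % 2 ≡ 1 → n ≡ 5 ⊎ ∃ λ s → n ≡ 7 + s * 2
oddView n 4≤n n%2≡1 = view (n / 2) (trans (m≡m%n+[m/n]*n n 2) (cong (_+ n / 2 * 2) n%2≡1)) 4≤n
  where
  view : ∀ {n} h → n ≡ 1 + h * 2 → 4 ≤ n → n ≡ 5 ⊎ ∃ λ s → n ≡ 7 + s * 2
  view 0                   refl (s≤s ())
  view 1                   refl (s≤s (s≤s (s≤s ())))
  view 2                   n≡   _ = inj₁ n≡
  view (suc (suc (suc s))) n≡   _ = inj₂ (s , n≡)

evenWheelBound : ∀ k n → 4 ≤ n → n % 2 ≡ 0 → RamseyWheelAtLeast (suc k) n (3 ^ k * (n ∸ 1) + 1)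
evenWheelBound k n 4≤n n%2≡0 with q , refl ← evenView n 4≤n n%2≡0 =
  ramseyBound 3 k (evenWheel-¬3-colourable q) (monochromaticColouring _) (+-comm k 1)

oddWheelBound : ∀ k n → 4 ≤ n → n % 2 ≡ 1 → RamseyWheelAtLeast (2 + k) n (2 ^ k * (2 * n ∸ 1) + 1)
oddWheelBound k n 4≤n n%2≡1 with oddView n 4≤n n%2≡1
... | inj₁ refl       = ramseyBound 2 k (wheel-¬2-colourable 2) FiveWheel.colouring (+-comm k 2)
... | inj₂ (s , refl) =
  ramseyBound 2 k (wheel-¬2-colourable (4 + s * 2)) (LargeOddWheel.colouring s) (+-comm k 2)

corollary1p6 : (k n : ℕ) → 2 ≤ k → 4 ≤ n →
    (n % 2 ≡ 0 → RamseyWheelAtLeast k n (3 ^ (k ∸ 1) * (n ∸ 1) + 1)) ×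
    (n % 2 ≡ 1 → RamseyWheelAtLeast k n (2 ^ (k ∸ 2) * (2 * n ∸ 1) + 1))
corollary1p6 (suc (suc k)) n (s≤s (s≤s z≤n)) 4≤n =
  evenWheelBound (suc k) n 4≤n , oddWheelBound k n 4≤n
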